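{- Let $s_1,\dots,s_k$ be nonnegative integers with $s_1+\dots+s_k\ge 2$. For every quasi-symmetric function $u$, the series \[ \eta_{s_1,\dots,s_k}(u)=\sum_{n=1}^\infty\frac{u(1,\frac12,\dots,\frac1n)}{n^{s_1}(n+1)^{s_2}\cdots(n+k-1)^{s_k}} \] converges.
   Context: Quasi-symmetric functions are formal power series of bounded degree in variables $x_1,x_2,\dots$; they form the ring spanned (over $\mathbb{Q}$) by the monomial quasi-symmetric functions $M_I=\sum_{n_1<n_2<\dots<n_j}x_{n_1}^{i_1}\cdots x_{n_j}^{i_j}$ for compositions $I=(i_1,\dots,i_j)$ (tuples of positive integers), together with $1$. For reals $a_1,\dots,a_n$, $u(a_1,\dots,a_n)$ denotes the image of $u$ under the homomorphism sending $x_i\mapsto a_i$ for $i\le n$ and $x_i\mapsto 0$ for $i>n$; e.g. $M_I(1,\frac12,\dots,\frac1n)=\sum_{1\le n_1<\dots<n_j\le n}n_1^{ -i_1}\cdots n_j^{ -i_j}$. -}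

module Defs where

open import Data.Nat as ℕ using (ℕ; zero; suc; NonZero)
open import Data.Nat.Properties as ℕP using ()
open import Data.Integer using (+_)
open import Data.Rational using (ℚ; 0ℚ; 1ℚ; _+_; _*_; _-_; _/_; ∣_∣; _<_; Positive)
open import Data.List using (List; []; _∷_; map; upTo)
open import Data.List.Relation.Unary.All using (All)
open import Data.Bool using (if_then_else_)
open import Data.Product using (Σ; _×_; _,_; proj₁; proj₂)

Composition : Set
Composition = Σ (List ℕ) (All NonZero)

-- A quasi-symmetric function over ℚ, given as a finite ℚ-linear combination
-- Σ c_I · M_I of monomial quasi-symmetric functions (M_() = 1).
QSym : Set
QSym = List (ℚ × Composition)

sumℚ : List ℚ → ℚ
sumℚ [] = 0ℚ
sumℚ (x ∷ xs) = x + sumℚ xs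

_^ℚ_ : ℚ → ℕ → ℚ
q ^ℚ zero = 1ℚ
q ^ℚ suc k = q * (q ^ℚ k)

recip : ℕ → ℚ
recip m = (+ 1) / suc m      -- recip m = 1/(m+1)

-- Msum I lo n = Σ_{lo < n₁ < … < n_j ≤ n} n₁^{-i₁} ⋯ n_j^{-i_j}
-- (for I = (i₁,…,i_j)).
Msum : List ℕ → ℕ → ℕ → ℚ
Msum [] lo n = 1ℚ
Msum (i ∷ I) lo n =
  sumℚ (map (λ m → if lo ℕ.<ᵇ suc m then (recip m ^ℚ i) * Msum I (suc m) n else 0ℚ)
            (upTo n))
  -- m ranges over 0,…,n-1 and stands for the index m+1 ∈ {1,…,n}

evalM : Composition → ℕ → ℚ
evalM I n = Msum (proj₁ I) 0 n

evalQ : QSym → ℕ → ℚ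
evalQ u n = sumℚ (map (λ cI → proj₁ cI * evalM (proj₂ cI) n) u)

denomFrom : List ℕ → ℕ → ℕ
denomFrom [] n = 1
denomFrom (s ∷ ss) n = (n ℕ.^ s) ℕ.* denomFrom ss (suc n)

-- η-term for index n+1 (n ≥ 0):  u(1,…,1/(n+1)) / ((n+1)^{s₁}⋯(n+k)^{s_k})
etaTerm : List ℕ → QSym → ℕ → ℚ
etaTerm s u n = evalQ u (suc n) * (1/ℕ (denomFrom s (suc n)))
  where
    1/ℕ : ℕ → ℚ
    1/ℕ zero = 0ℚ            -- never used: the denominator is ≥ 1
    1/ℕ (suc d) = (+ 1) / suc d

partialEta : List ℕ → QSym → ℕ → ℚ
partialEta s u N = sumℚ (map (etaTerm s u) (upTo N))

-- A series with rational terms converges (in ℝ) iff its partial sums form a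
-- Cauchy sequence (completeness of ℝ); ε ranges over positive rationals.
CauchySeq : (ℕ → ℚ) → Set
CauchySeq S = ∀ (ε : ℚ) → Positive ε →
  Σ ℕ λ N → ∀ m n → N ℕ.≤ m → N ℕ.≤ n → ∣ S m - S n ∣ < ε

-- Bounding 1/m^i by 1/m = 2 · 1/(2m) and summing with the telescoping identity
-- ∏ (1 + x_m) = 1 + Σ_m x_m ∏_{k>m} (1 + x_k) gives |u(1, 1/2, …, 1/n)| ≤ C · Π_n, where
-- Π_n = ∏_{k≤n} (1 + 1/(2k)). As Π_n² / n is decreasing, Π_n = O(√n). The denominator of
-- the n-th term is at least n², so the term is at most C · Π_n / n², and γ_n = 4 Π_n / n is a
-- telescoping majorant: C Π_n / n² + C γ_{n+1} ≤ C γ_n. Every tail of the series is thus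
-- bounded by C γ_N = O(1/√N).
module Submission where

open import Defs

module Estimates where

  open import Data.Bool using (true; false; if_then_else_)
  import Data.Integer as ℤ
  import Data.Integer.Properties as ℤ
  open import Data.List using ([]; _∷_; map; upTo; applyUpTo; length)
  open import Data.List.Properties using (map-upTo)
  open import Data.List.Relation.Unary.All using (All; []; _∷_)
  open import Data.Maybe using (Maybe; just; nothing)
  open import Data.Nat as ℕ using (ℕ; zero; suc)
  import Data.Nat.Coprimality as Coprime
  open import Data.Nat.ListAction using (sum)
  import Data.Nat.Properties as ℕ
  open import Data.Product using (∃-syntax; _,_)
  open import Data.Rational
  open import Data.Rational.Properties
  open import Data.Sum using (inj₁; inj₂)
  open import Function using (_∘_)
  open import Relation.Binary.PropositionalEquality
  open import Relation.Nullary using (yes; no; contradiction)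
  open import Tactic.RingSolver using (solve-∀)
  import Tactic.RingSolver.Core.AlmostCommutativeRing as ACR

  ℚ-ring : ACR.AlmostCommutativeRing _ _
  ℚ-ring = ACR.fromCommutativeRing +-*-commutativeRing is0
    where
    is0 : ∀ x → Maybe (0ℚ ≡ x)
    is0 x with x ≟ 0ℚ
    ... | yes x≡0 = just (sym x≡0)
    ... | no _    = nothing

  0≤1 : 0ℚ ≤ 1ℚ
  0≤1 = nonNegative⁻¹ 1ℚ

  *-0≤ : ∀ {p q} → 0ℚ ≤ p → 0ℚ ≤ q → 0ℚ ≤ p * q
  *-0≤ {p} {q} 0≤p 0≤q = nonNegative⁻¹ _ {{nonNeg*nonNeg⇒nonNeg p {{nonNegative 0≤p}} q {{nonNegative 0≤q}}}}

  *-monoˡ-≤-0≤ : ∀ {r p q} → 0ℚ ≤ r → p ≤ q → r * p ≤ r * q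
  *-monoˡ-≤-0≤ {r} 0≤r = *-monoˡ-≤-nonNeg r {{nonNegative 0≤r}}

  *-monoʳ-≤-0≤ : ∀ {r p q} → 0ℚ ≤ r → p ≤ q → p * r ≤ q * r
  *-monoʳ-≤-0≤ {r} 0≤r = *-monoʳ-≤-nonNeg r {{nonNegative 0≤r}}

  *-mono-≤-0≤ : ∀ {p q r s} → 0ℚ ≤ p → 0ℚ ≤ r → p ≤ q → r ≤ s → p * r ≤ q * s
  *-mono-≤-0≤ 0≤p 0≤r p≤q r≤s = ≤-trans (*-monoʳ-≤-0≤ 0≤r p≤q) (*-monoˡ-≤-0≤ (≤-trans 0≤p p≤q) r≤s)

  p≤p+q : ∀ {p q} → 0ℚ ≤ q → p ≤ p + q
  p≤p+q {p} 0≤q = ≤-trans (≤-reflexive (sym (+-identityʳ p))) (+-monoʳ-≤ p 0≤q)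

  p²<q²⇒p<q : ∀ {p q} → 0ℚ ≤ q → p * p < q * q → p < q
  p²<q²⇒p<q 0≤q p²<q² = ≰⇒> λ q≤p → <-irrefl refl (<-≤-trans p²<q² (*-mono-≤-0≤ 0≤q 0≤q q≤p q≤p))

  ∣p*q∣≡∣p∣*q : ∀ p {q} → 0ℚ ≤ q → ∣ p * q ∣ ≡ ∣ p ∣ * q
  ∣p*q∣≡∣p∣*q p {q} 0≤q = trans (∣p*q∣≡∣p∣*∣q∣ p q) (cong (∣ p ∣ *_) (0≤p⇒∣p∣≡p 0≤q))

  ∣p-q∣≡∣q-p∣ : ∀ p q → ∣ p - q ∣ ≡ ∣ q - p ∣
  ∣p-q∣≡∣q-p∣ p q = trans (sym (∣-p∣≡∣p∣ (p - q))) (cong ∣_∣ (neg-diff p q))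
    where
    neg-diff : ∀ p q → - (p - q) ≡ q - p
    neg-diff = solve-∀ ℚ-ring

  -- The shape of partialEta and of Msum, which are thus definitionally instances of ∑.
  ∑ : (ℕ → ℚ) → ℕ → ℚ
  ∑ f n = sumℚ (map f (upTo n))

  ∑-suc : ∀ f n → ∑ f (suc n) ≡ ∑ f n + f n
  ∑-suc f n = trans (cong sumℚ (map-upTo f (suc n)))
                (trans (applyUpTo-suc f n) (cong (_+ f n) (sym (cong sumℚ (map-upTo f n)))))
    where
    applyUpTo-suc : ∀ f n → sumℚ (applyUpTo f (suc n)) ≡ sumℚ (applyUpTo f n) + f n
    applyUpTo-suc f zero    = trans (+-identityʳ (f 0)) (sym (+-identityˡ (f 0)))
    applyUpTo-suc f (suc n) = trans (cong (f 0 +_) (applyUpTo-suc (f ∘ suc) n)) (sym (+-assoc (f 0) _ _))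

  ∑-cong : ∀ {f g} n → (∀ m → m ℕ.< n → f m ≡ g m) → ∑ f n ≡ ∑ g n
  ∑-cong zero    _  = refl
  ∑-cong {f} {g} (suc n) f≡g = begin
    ∑ f (suc n)   ≡⟨ ∑-suc f n ⟩
    ∑ f n + f n   ≡⟨ cong₂ _+_ (∑-cong n (λ m m<n → f≡g m (ℕ.m<n⇒m<1+n m<n))) (f≡g n ℕ.≤-refl) ⟩
    ∑ g n + g n   ≡⟨ ∑-suc g n ⟨
    ∑ g (suc n)   ∎
    where open ≡-Reasoning

  ∑-mono-≤ : ∀ {f g} n → (∀ m → m ℕ.< n → f m ≤ g m) → ∑ f n ≤ ∑ g n
  ∑-mono-≤ zero    _  = ≤-refl
  ∑-mono-≤ {f} {g} (suc n) f≤g = begin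
    ∑ f (suc n)   ≡⟨ ∑-suc f n ⟩
    ∑ f n + f n   ≤⟨ +-mono-≤ (∑-mono-≤ n (λ m m<n → f≤g m (ℕ.m<n⇒m<1+n m<n))) (f≤g n ℕ.≤-refl) ⟩
    ∑ g n + g n   ≡⟨ ∑-suc g n ⟨
    ∑ g (suc n)   ∎
    where open ≤-Reasoning

  ∑-0≤ : ∀ {f} n → (∀ m → 0ℚ ≤ f m) → 0ℚ ≤ ∑ f n
  ∑-0≤ {f} n 0≤f = ≤-trans (≤-reflexive (sym (∑-zero n))) (∑-mono-≤ n (λ m _ → 0≤f m))
    where
    ∑-zero : ∀ n → ∑ (λ _ → 0ℚ) n ≡ 0ℚ
    ∑-zero zero    = refl
    ∑-zero (suc n) = trans (∑-suc _ n) (cong (_+ 0ℚ) (∑-zero n))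

  ∑-*ʳ : ∀ f c n → ∑ (λ m → f m * c) n ≡ ∑ f n * c
  ∑-*ʳ f c zero    = sym (*-zeroˡ c)
  ∑-*ʳ f c (suc n) = begin
    ∑ (λ m → f m * c) (suc n)    ≡⟨ ∑-suc _ n ⟩
    ∑ (λ m → f m * c) n + f n * c ≡⟨ cong (_+ f n * c) (∑-*ʳ f c n) ⟩
    ∑ f n * c + f n * c           ≡⟨ *-distribʳ-+ c (∑ f n) (f n) ⟨
    (∑ f n + f n) * c             ≡⟨ cong (_* c) (∑-suc f n) ⟨
    ∑ f (suc n) * c               ∎
    where open ≡-Reasoning

  ∣∑∣≤∑∣∣ : ∀ f n → ∣ ∑ f n ∣ ≤ ∑ (∣_∣ ∘ f) n
  ∣∑∣≤∑∣∣ f zero    = ≤-refl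
  ∣∑∣≤∑∣∣ f (suc n) = begin
    ∣ ∑ f (suc n) ∣         ≡⟨ cong ∣_∣ (∑-suc f n) ⟩
    ∣ ∑ f n + f n ∣         ≤⟨ ∣p+q∣≤∣p∣+∣q∣ (∑ f n) (f n) ⟩
    ∣ ∑ f n ∣ + ∣ f n ∣     ≤⟨ +-monoˡ-≤ ∣ f n ∣ (∣∑∣≤∑∣∣ f n) ⟩
    ∑ (∣_∣ ∘ f) n + ∣ f n ∣ ≡⟨ ∑-suc (∣_∣ ∘ f) n ⟨
    ∑ (∣_∣ ∘ f) (suc n)     ∎
    where open ≤-Reasoning

  ∑-+ : ∀ f m d → ∑ f (m ℕ.+ d) ≡ ∑ f m + ∑ (f ∘ (m ℕ.+_)) d
  ∑-+ f m zero    = trans (cong (∑ f) (ℕ.+-identityʳ m)) (sym (+-identityʳ (∑ f m)))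
  ∑-+ f m (suc d) = begin
    ∑ f (m ℕ.+ suc d)                             ≡⟨ cong (∑ f) (ℕ.+-suc m d) ⟩
    ∑ f (suc (m ℕ.+ d))                           ≡⟨ ∑-suc f (m ℕ.+ d) ⟩
    ∑ f (m ℕ.+ d) + f (m ℕ.+ d)                   ≡⟨ cong (_+ f (m ℕ.+ d)) (∑-+ f m d) ⟩
    (∑ f m + ∑ (f ∘ (m ℕ.+_)) d) + f (m ℕ.+ d)    ≡⟨ +-assoc (∑ f m) _ _ ⟩
    ∑ f m + (∑ (f ∘ (m ℕ.+_)) d + f (m ℕ.+ d))    ≡⟨ cong (∑ f m +_) (∑-suc (f ∘ (m ℕ.+_)) d) ⟨
    ∑ f m + ∑ (f ∘ (m ℕ.+_)) (suc d)              ∎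
    where open ≡-Reasoning

  ∣∑-∑∣≡∣∑∣ : ∀ f {m n} → m ℕ.≤ n → ∣ ∑ f n - ∑ f m ∣ ≡ ∣ ∑ (f ∘ (m ℕ.+_)) (n ℕ.∸ m) ∣
  ∣∑-∑∣≡∣∑∣ f {m} {n} m≤n = begin
    ∣ ∑ f n - ∑ f m ∣                   ≡⟨ cong (λ k → ∣ ∑ f k - ∑ f m ∣) (ℕ.m+[n∸m]≡n m≤n) ⟨
    ∣ ∑ f (m ℕ.+ d) - ∑ f m ∣           ≡⟨ cong (λ x → ∣ x - ∑ f m ∣) (∑-+ f m d) ⟩
    ∣ (∑ f m + ∑ (f ∘ (m ℕ.+_)) d) - ∑ f m ∣ ≡⟨ cong ∣_∣ (cancel (∑ f m) _) ⟩
    ∣ ∑ (f ∘ (m ℕ.+_)) d ∣              ∎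
    where
    open ≡-Reasoning
    d = n ℕ.∸ m
    cancel : ∀ x y → (x + y) - x ≡ y
    cancel = solve-∀ ℚ-ring

  module _ (a b G : ℕ → ℚ) (∣a∣≤b : ∀ n → ∣ a n ∣ ≤ b n) (b+G≤G : ∀ n → b n + G (suc n) ≤ G n)
           (0≤G : ∀ n → 0ℚ ≤ G n) where

    private
      ∑b+G≤G : ∀ m d → ∑ (b ∘ (m ℕ.+_)) d + G (m ℕ.+ d) ≤ G m
      ∑b+G≤G m zero = ≤-reflexive (trans (+-identityˡ _) (cong G (ℕ.+-identityʳ m)))
      ∑b+G≤G m (suc d) = begin
        ∑ b′ (suc d) + G (m ℕ.+ suc d)             ≡⟨ cong₂ _+_ (∑-suc b′ d) (cong G (ℕ.+-suc m d)) ⟩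
        (∑ b′ d + b′ d) + G (suc (m ℕ.+ d))        ≡⟨ +-assoc (∑ b′ d) _ _ ⟩
        ∑ b′ d + (b′ d + G (suc (m ℕ.+ d)))        ≤⟨ +-monoʳ-≤ (∑ b′ d) (b+G≤G (m ℕ.+ d)) ⟩
        ∑ b′ d + G (m ℕ.+ d)                       ≤⟨ ∑b+G≤G m d ⟩
        G m                                        ∎
        where
        open ≤-Reasoning
        b′ = b ∘ (m ℕ.+_)

      0≤b : ∀ n → 0ℚ ≤ b n
      0≤b n = ≤-trans (0≤∣p∣ (a n)) (∣a∣≤b n)

      G-antitone : ∀ {m n} → m ℕ.≤ n → G n ≤ G m
      G-antitone {m} {n} m≤n = begin
        G n                                              ≡⟨ cong G (ℕ.m+[n∸m]≡n m≤n) ⟨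
        G (m ℕ.+ d)                                      ≡⟨ +-identityˡ (G (m ℕ.+ d)) ⟨
        0ℚ + G (m ℕ.+ d)                                 ≤⟨ +-monoˡ-≤ (G (m ℕ.+ d)) (∑-0≤ d (0≤b ∘ (m ℕ.+_))) ⟩
        ∑ (b ∘ (m ℕ.+_)) d + G (m ℕ.+ d)                 ≤⟨ ∑b+G≤G m d ⟩
        G m                                              ∎
        where
        open ≤-Reasoning
        d = n ℕ.∸ m

      ∣∑a∣≤G : ∀ m d → ∣ ∑ (a ∘ (m ℕ.+_)) d ∣ ≤ G m
      ∣∑a∣≤G m d = begin
        ∣ ∑ (a ∘ (m ℕ.+_)) d ∣             ≤⟨ ∣∑∣≤∑∣∣ (a ∘ (m ℕ.+_)) d ⟩
        ∑ (∣_∣ ∘ a ∘ (m ℕ.+_)) d           ≤⟨ ∑-mono-≤ d (λ k _ → ∣a∣≤b (m ℕ.+ k)) ⟩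
        ∑ (b ∘ (m ℕ.+_)) d                 ≤⟨ p≤p+q (0≤G (m ℕ.+ d)) ⟩
        ∑ (b ∘ (m ℕ.+_)) d + G (m ℕ.+ d)   ≤⟨ ∑b+G≤G m d ⟩
        G m                                ∎
        where open ≤-Reasoning

    ∑-cauchy-by-telescoping : (∀ ε → Positive ε → ∃[ N ] G N < ε) → CauchySeq (∑ a)
    ∑-cauchy-by-telescoping G→0 ε ε>0 with G→0 ε ε>0
    ... | N , GN<ε = N , close
      where
      close-≤ : ∀ {m n} → N ℕ.≤ m → m ℕ.≤ n → ∣ ∑ a n - ∑ a m ∣ < ε
      close-≤ {m} {n} N≤m m≤n = begin-strict
        ∣ ∑ a n - ∑ a m ∣                   ≡⟨ ∣∑-∑∣≡∣∑∣ a m≤n ⟩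
        ∣ ∑ (a ∘ (m ℕ.+_)) (n ℕ.∸ m) ∣      ≤⟨ ∣∑a∣≤G m (n ℕ.∸ m) ⟩
        G m                                 ≤⟨ G-antitone N≤m ⟩
        G N                                 <⟨ GN<ε ⟩
        ε                                   ∎
        where open ≤-Reasoning
      close : ∀ m n → N ℕ.≤ m → N ℕ.≤ n → ∣ ∑ a m - ∑ a n ∣ < ε
      close m n N≤m N≤n with ℕ.≤-total m n
      ... | inj₁ m≤n = subst (_< ε) (∣p-q∣≡∣q-p∣ (∑ a n) (∑ a m)) (close-≤ N≤m m≤n)
      ... | inj₂ n≤m = close-≤ N≤n n≤m

  *-telescoping : ∀ {c} {b G : ℕ → ℚ} → 0ℚ ≤ c → (∀ n → b n + G (suc n) ≤ G n) →
                  ∀ n → c * b n + c * G (suc n) ≤ c * G n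
  *-telescoping {c} {b} {G} 0≤c b+G≤G n =
    subst (_≤ c * G n) (*-distribˡ-+ c (b n) (G (suc n))) (*-monoˡ-≤-0≤ 0≤c (b+G≤G n))

  ι : ℕ → ℚ
  ι zero    = 0ℚ
  ι (suc n) = 1ℚ + ι n

  ι≡n/1 : ∀ n → ι n ≡ mkℚ (ℤ.+ n) 0 (Coprime.sym (Coprime.1-coprimeTo n))
  ι≡n/1 zero = refl
  ι≡n/1 (suc n) rewrite ι≡n/1 n | ℤ.*-identityʳ (ℤ.+ n) = normalize-coprime _

  0≤ι : ∀ n → 0ℚ ≤ ι n
  0≤ι zero    = ≤-refl
  0≤ι (suc n) = +-mono-≤ 0≤1 (0≤ι n)

  ι-+ : ∀ m n → ι (m ℕ.+ n) ≡ ι m + ι n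
  ι-+ zero    n = sym (+-identityˡ (ι n))
  ι-+ (suc m) n = trans (cong (1ℚ +_) (ι-+ m n)) (sym (+-assoc 1ℚ (ι m) (ι n)))

  ι-* : ∀ m n → ι (m ℕ.* n) ≡ ι m * ι n
  ι-* zero    n = sym (*-zeroˡ (ι n))
  ι-* (suc m) n = begin
    ι (n ℕ.+ m ℕ.* n)    ≡⟨ ι-+ n (m ℕ.* n) ⟩
    ι n + ι (m ℕ.* n)    ≡⟨ cong (ι n +_) (ι-* m n) ⟩
    ι n + ι m * ι n      ≡⟨ distrib (ι n) (ι m) ⟩
    (1ℚ + ι m) * ι n     ∎
    where
    open ≡-Reasoning
    distrib : ∀ x y → x + y * x ≡ (1ℚ + y) * x
    distrib = solve-∀ ℚ-ring

  ι-mono-≤ : ∀ {m n} → m ℕ.≤ n → ι m ≤ ι n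
  ι-mono-≤ {m} {n} m≤n = begin
    ι m                  ≤⟨ p≤p+q (0≤ι (n ℕ.∸ m)) ⟩
    ι m + ι (n ℕ.∸ m)    ≡⟨ ι-+ m (n ℕ.∸ m) ⟨
    ι (m ℕ.+ (n ℕ.∸ m))  ≡⟨ cong ι (ℕ.m+[n∸m]≡n m≤n) ⟩
    ι n                  ∎
    where open ≤-Reasoning

  recip≡1/n : ∀ m → recip m ≡ mkℚ (ℤ.+ 1) m (Coprime.1-coprimeTo (suc m))
  recip≡1/n m = normalize-coprime _

  recip-*-ι : ∀ m → recip m * ι (suc m) ≡ 1ℚ
  recip-*-ι m rewrite recip≡1/n m | ι≡n/1 (suc m) =
    *-inverseˡ (mkℚ (ℤ.+ suc m) 0 (Coprime.sym (Coprime.1-coprimeTo (suc m))))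

  0≤recip : ∀ m → 0ℚ ≤ recip m
  0≤recip m = nonNegative⁻¹ _ {{normalize-nonNeg 1 (suc m)}}

  recip-pos : ∀ m → Positive (recip m)
  recip-pos m = normalize-pos 1 (suc m)

  recip≤1 : ∀ m → recip m ≤ 1ℚ
  recip≤1 m = begin
    recip m                 ≡⟨ *-identityʳ (recip m) ⟨
    recip m * 1ℚ            ≤⟨ *-monoˡ-≤-0≤ (0≤recip m) (p≤p+q (0≤ι m)) ⟩
    recip m * ι (suc m)     ≡⟨ recip-*-ι m ⟩
    1ℚ                      ∎
    where open ≤-Reasoning

  recip-unique : ∀ x c → x * ι (suc c) ≡ 1ℚ → x ≡ recip c
  recip-unique x c x*ι≡1 = begin
    x                           ≡⟨ *-identityʳ x ⟨
    x * 1ℚ                      ≡⟨ cong (x *_) (trans (*-comm (ι (suc c)) (recip c)) (recip-*-ι c)) ⟨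
    x * (ι (suc c) * recip c)   ≡⟨ *-assoc x _ _ ⟨
    (x * ι (suc c)) * recip c   ≡⟨ cong (_* recip c) x*ι≡1 ⟩
    1ℚ * recip c                ≡⟨ *-identityˡ (recip c) ⟩
    recip c                     ∎
    where open ≡-Reasoning

  recip-antitone : ∀ {m n} → m ℕ.≤ n → recip n ≤ recip m
  recip-antitone {m} {n} m≤n = begin
    recip n                              ≡⟨ *-identityʳ (recip n) ⟨
    recip n * 1ℚ                         ≡⟨ cong (recip n *_) (recip-*-ι m) ⟨
    recip n * (recip m * ι (suc m))      ≤⟨ *-monoˡ-≤-0≤ (0≤recip n) (*-monoˡ-≤-0≤ (0≤recip m) (ι-mono-≤ (ℕ.s≤s m≤n))) ⟩
    recip n * (recip m * ι (suc n))      ≡⟨ swap (recip n) (recip m) (ι (suc n)) ⟩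
    recip m * (recip n * ι (suc n))      ≡⟨ cong (recip m *_) (recip-*-ι n) ⟩
    recip m * 1ℚ                         ≡⟨ *-identityʳ (recip m) ⟩
    recip m                              ∎
    where
    open ≤-Reasoning
    swap : ∀ x y z → x * (y * z) ≡ y * (x * z)
    swap = solve-∀ ℚ-ring

  recip-* : ∀ m n → recip m * recip n ≡ recip (n ℕ.+ m ℕ.* suc n)
  recip-* m n = recip-unique (recip m * recip n) (n ℕ.+ m ℕ.* suc n) (begin
    (recip m * recip n) * ι (suc m ℕ.* suc n)             ≡⟨ cong ((recip m * recip n) *_) (ι-* (suc m) (suc n)) ⟩
    (recip m * recip n) * (ι (suc m) * ι (suc n))         ≡⟨ interchange (recip m) (recip n) _ _ ⟩
    (recip m * ι (suc m)) * (recip n * ι (suc n))         ≡⟨ cong₂ _*_ (recip-*-ι m) (recip-*-ι n) ⟩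
    1ℚ * 1ℚ                                               ≡⟨⟩
    1ℚ                                                    ∎)
    where
    open ≡-Reasoning
    interchange : ∀ x y z w → (x * y) * (z * w) ≡ (x * z) * (y * w)
    interchange = solve-∀ ℚ-ring

  recip-suc : ∀ n → recip (suc n) + recip n * recip (suc n) ≡ recip n
  recip-suc n = recip-unique _ n (begin
    (q′ + q * q′) * ι (suc n)          ≡⟨ expand q q′ (ι (suc n)) ⟩
    q′ * ι (suc n) + q′ * (q * ι (suc n)) ≡⟨ cong (λ x → q′ * ι (suc n) + q′ * x) (recip-*-ι n) ⟩
    q′ * ι (suc n) + q′ * 1ℚ           ≡⟨ collect q′ (ι (suc n)) ⟩
    q′ * ι (suc (suc n))               ≡⟨ recip-*-ι (suc n) ⟩
    1ℚ                                 ∎)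
    where
    open ≡-Reasoning
    q = recip n
    q′ = recip (suc n)
    expand : ∀ q q′ x → (q′ + q * q′) * x ≡ q′ * x + q′ * (q * x)
    expand = solve-∀ ℚ-ring
    collect : ∀ q′ x → q′ * x + q′ * 1ℚ ≡ q′ * (1ℚ + x)
    collect = solve-∀ ℚ-ring

  two : ℚ
  two = 1ℚ + 1ℚ

  recip≤two*recip-suc : ∀ n → recip n ≤ two * recip (suc n)
  recip≤two*recip-suc n = begin
    recip n                   ≡⟨ recip-suc n ⟨
    q′ + recip n * q′         ≤⟨ +-monoʳ-≤ q′ (*-monoʳ-≤-0≤ (0≤recip (suc n)) (recip≤1 n)) ⟩
    q′ + 1ℚ * q′              ≡⟨ double q′ ⟩
    two * q′                  ∎
    where
    open ≤-Reasoning
    q′ = recip (suc n)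
    double : ∀ x → x + 1ℚ * x ≡ two * x
    double = solve-∀ ℚ-ring

  ≤ι : ∀ z → ∃[ j ] z ≤ ι j
  ≤ι (mkℚ (ℤ.+ k) d c) = k , subst (mkℚ (ℤ.+ k) d c ≤_) (sym (ι≡n/1 k))
    (*≤* (ℤ.*-monoˡ-≤-nonNeg (ℤ.+ k) (ℤ.+≤+ (ℕ.s≤s ℕ.z≤n))))
  ≤ι (mkℚ ℤ.-[1+ k ] d c) = 0 , *≤* ℤ.-≤+

  recip≤ : ∀ y → 0ℚ < y → ∃[ d ] recip d ≤ y
  recip≤ (mkℚ ℤ.+[1+ a ] d c) _ = d , subst (_≤ mkℚ ℤ.+[1+ a ] d c) (sym (recip≡1/n d))
    (*≤* (ℤ.*-monoʳ-≤-nonNeg (ℤ.+ suc d) {ℤ.+ 1} {ℤ.+[1+ a ]} (ℤ.+≤+ (ℕ.s≤s ℕ.z≤n))))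
  recip≤ (mkℚ (ℤ.+ 0) d c) (*<* (ℤ.+<+ ()))
  recip≤ (mkℚ ℤ.-[1+ a ] d c) (*<* ())

  archimedean : ∀ z y → 0ℚ < y → ∃[ N ] z * recip N < y
  archimedean z y 0<y with ≤ι z | recip≤ y 0<y
  ... | j , z≤j | d , 1/d≤y = N , (begin-strict
    z * recip N                          ≤⟨ *-monoʳ-≤-0≤ (0≤recip N) z≤j ⟩
    ι j * recip N                        <⟨ *-monoˡ-<-pos (recip N) {{recip-pos N}} j<1+j ⟩
    ι (suc j) * recip N                  ≡⟨ cong (ι (suc j) *_) (recip-* j d) ⟨
    ι (suc j) * (recip j * recip d)      ≡⟨ *-assoc (ι (suc j)) _ _ ⟨
    (ι (suc j) * recip j) * recip d      ≡⟨ cong (_* recip d) (trans (*-comm (ι (suc j)) (recip j)) (recip-*-ι j)) ⟩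
    1ℚ * recip d                         ≡⟨ *-identityˡ (recip d) ⟩
    recip d                              ≤⟨ 1/d≤y ⟩
    y                                    ∎)
    where
    open ≤-Reasoning
    N = d ℕ.+ j ℕ.* suc d
    j<1+j : ι j < ι (suc j)
    j<1+j = subst (_< ι (suc j)) (+-identityˡ (ι j)) (+-monoˡ-< (ι j) (positive⁻¹ 1ℚ))

  -- The guard of Msum, so that its summands are definitionally of the form from lo f m.
  from : ℕ → (ℕ → ℚ) → ℕ → ℚ
  from lo f m = if lo ℕ.<ᵇ suc m then f m else 0ℚ

  from-≥ : ∀ {lo m} f → lo ℕ.≤ m → from lo f m ≡ f m
  from-≥ {lo} {m} f lo≤m with lo ℕ.<ᵇ suc m | ℕ.<⇒<ᵇ (ℕ.s≤s lo≤m)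
  ... | true | _ = refl

  from-< : ∀ {lo m} f → m ℕ.< lo → from lo f m ≡ 0ℚ
  from-< {lo} {m} f m<lo with lo ℕ.<ᵇ suc m | ℕ.<ᵇ⇒< lo (suc m)
  ... | false | _        = refl
  ... | true  | lo<1+m   = contradiction (ℕ.m<1+n⇒m≤n (lo<1+m _)) (ℕ.<⇒≱ m<lo)

  from-cong : ∀ {f g} lo m → (lo ℕ.≤ m → f m ≡ g m) → from lo f m ≡ from lo g m
  from-cong lo m f≡g with lo ℕ.<ᵇ suc m | ℕ.<ᵇ⇒< lo (suc m)
  ... | true  | lo<1+m = f≡g (ℕ.m<1+n⇒m≤n (lo<1+m _))
  ... | false | _      = refl

  from-mono-≤ : ∀ {f g} lo → (∀ m → f m ≤ g m) → ∀ m → from lo f m ≤ from lo g m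
  from-mono-≤ lo f≤g m with lo ℕ.<ᵇ suc m
  ... | true  = f≤g m
  ... | false = ≤-refl

  from-0≤ : ∀ {f} lo → (∀ m → 0ℚ ≤ f m) → ∀ m → 0ℚ ≤ from lo f m
  from-0≤ lo 0≤f m with lo ℕ.<ᵇ suc m
  ... | true  = 0≤f m
  ... | false = ≤-refl

  from-*ʳ : ∀ lo f c m → from lo f m * c ≡ from lo (λ k → f k * c) m
  from-*ʳ lo f c m with lo ℕ.<ᵇ suc m
  ... | true  = refl
  ... | false = *-zeroˡ c

  ∏1+ : (ℕ → ℚ) → ℕ → ℕ → ℚ
  ∏1+ x lo zero    = 1ℚ
  ∏1+ x lo (suc n) = ∏1+ x lo n * (1ℚ + from lo x n)

  ∏1+-empty : ∀ x {lo n} → n ℕ.≤ lo → ∏1+ x lo n ≡ 1ℚ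
  ∏1+-empty x {n = zero}  _    = refl
  ∏1+-empty x {n = suc n} n<lo rewrite ∏1+-empty x (ℕ.<⇒≤ n<lo) | from-< x n<lo = refl

  1≤∏1+ : ∀ {x} → (∀ m → 0ℚ ≤ x m) → ∀ lo n → 1ℚ ≤ ∏1+ x lo n
  1≤∏1+ 0≤x lo zero    = ≤-refl
  1≤∏1+ 0≤x lo (suc n) = *-mono-≤-0≤ 0≤1 0≤1 (1≤∏1+ 0≤x lo n) (p≤p+q (from-0≤ lo 0≤x n))

  0≤∏1+ : ∀ {x} → (∀ m → 0ℚ ≤ x m) → ∀ lo n → 0ℚ ≤ ∏1+ x lo n
  0≤∏1+ 0≤x lo n = ≤-trans 0≤1 (1≤∏1+ 0≤x lo n)

  ∑+1≡∏1+ : ∀ x lo n → ∑ (from lo (λ m → x m * ∏1+ x (suc m) n)) n + 1ℚ ≡ ∏1+ x lo n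
  ∑+1≡∏1+ x lo zero    = refl
  ∑+1≡∏1+ x lo (suc n) = begin
    ∑ (h (suc n)) (suc n) + 1ℚ                ≡⟨ cong (_+ 1ℚ) (∑-suc (h (suc n)) n) ⟩
    (∑ (h (suc n)) n + h (suc n) n) + 1ℚ      ≡⟨ cong (λ s → (s + h (suc n) n) + 1ℚ) (∑-cong n h-suc) ⟩
    (∑ (λ m → h n m * c) n + h (suc n) n) + 1ℚ ≡⟨ cong₂ (λ s t → (s + t) + 1ℚ) (∑-*ʳ (h n) c n) h-last ⟩
    (∑ (h n) n * c + y) + 1ℚ                  ≡⟨ telescope (∑ (h n) n) y ⟩
    (∑ (h n) n + 1ℚ) * c                      ≡⟨ cong (_* c) (∑+1≡∏1+ x lo n) ⟩
    ∏1+ x lo n * c                            ∎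
    where
    open ≡-Reasoning
    term : ℕ → ℕ → ℚ
    term n m = x m * ∏1+ x (suc m) n
    h : ℕ → ℕ → ℚ
    h n = from lo (term n)
    y = from lo x n
    c = 1ℚ + y
    h-suc : ∀ m → m ℕ.< n → h (suc n) m ≡ h n m * c
    h-suc m m<n = trans (from-cong {term (suc n)} {λ k → term n k * c} lo m last-factor)
                        (sym (from-*ʳ lo (term n) c m))
      where
      last-factor : lo ℕ.≤ m → x m * ∏1+ x (suc m) (suc n) ≡ x m * ∏1+ x (suc m) n * c
      last-factor lo≤m = begin
        x m * (∏1+ x (suc m) n * (1ℚ + from (suc m) x n))  ≡⟨ cong (λ z → x m * (∏1+ x (suc m) n * (1ℚ + z))) x-n≡y ⟩
        x m * (∏1+ x (suc m) n * c)                        ≡⟨ *-assoc (x m) _ _ ⟨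
        x m * ∏1+ x (suc m) n * c                          ∎
        where
        x-n≡y : from (suc m) x n ≡ y
        x-n≡y = trans (from-≥ x m<n) (sym (from-≥ x (ℕ.≤-trans lo≤m (ℕ.<⇒≤ m<n))))
    h-last : h (suc n) n ≡ y
    h-last = from-cong {term (suc n)} {x} lo n λ _ → (trans
      (cong₂ (λ p z → x n * (p * (1ℚ + z))) (∏1+-empty x (ℕ.n≤1+n n)) (from-< x (ℕ.n<1+n n)))
      (*-identityʳ (x n)))
    telescope : ∀ s y → (s * (1ℚ + y) + y) + 1ℚ ≡ (s + 1ℚ) * (1ℚ + y)
    telescope = solve-∀ ℚ-ring

  0≤^ℚ : ∀ {p} → 0ℚ ≤ p → ∀ k → 0ℚ ≤ p ^ℚ k
  0≤^ℚ 0≤p zero    = 0≤1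
  0≤^ℚ 0≤p (suc k) = *-0≤ 0≤p (0≤^ℚ 0≤p k)

  ^ℚ≤1 : ∀ {p} → 0ℚ ≤ p → p ≤ 1ℚ → ∀ k → p ^ℚ k ≤ 1ℚ
  ^ℚ≤1 0≤p p≤1 zero    = ≤-refl
  ^ℚ≤1 0≤p p≤1 (suc k) = *-mono-≤-0≤ 0≤p (0≤^ℚ 0≤p k) p≤1 (^ℚ≤1 0≤p p≤1 k)

  ^ℚ-suc-≤ : ∀ {p} → 0ℚ ≤ p → p ≤ 1ℚ → ∀ k → p ^ℚ suc k ≤ p
  ^ℚ-suc-≤ {p} 0≤p p≤1 k = ≤-trans (*-monoˡ-≤-0≤ 0≤p (^ℚ≤1 0≤p p≤1 k)) (≤-reflexive (*-identityʳ p))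

  ρ : ℕ → ℚ
  ρ m = ½ * recip m

  0≤ρ : ∀ m → 0ℚ ≤ ρ m
  0≤ρ m = *-0≤ (nonNegative⁻¹ ½) (0≤recip m)

  Msum-0≤ : ∀ I lo n → 0ℚ ≤ Msum I lo n
  Msum-0≤ []      lo n = 0≤1
  Msum-0≤ (i ∷ I) lo n =
    ∑-0≤ n (from-0≤ lo (λ m → *-0≤ (0≤^ℚ (0≤recip m) i) (Msum-0≤ I (suc m) n)))

  -- Each part i ≥ 1 gives recip m ^ℚ i ≤ recip m = 2 · ρ m, and ∑+1≡∏1+ then absorbs the sum.
  Msum≤ : ∀ I → All ℕ.NonZero I → ∀ lo n → Msum I lo n ≤ two ^ℚ length I * ∏1+ ρ lo n
  Msum≤ [] [] lo n = ≤-trans (1≤∏1+ 0≤ρ lo n) (≤-reflexive (sym (*-identityˡ _)))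
  Msum≤ (zero ∷ I) (record { nonZero = () } ∷ _)
  Msum≤ (suc i ∷ I) (_ ∷ I≢0) lo n = begin
    ∑ (from lo f) n                         ≤⟨ ∑-mono-≤ n (λ m _ → f≤g*K m) ⟩
    ∑ (λ m → from lo g m * K) n             ≡⟨ ∑-*ʳ (from lo g) K n ⟩
    ∑ (from lo g) n * K                     ≤⟨ *-monoʳ-≤-0≤ 0≤K (p≤p+q {∑ (from lo g) n} 0≤1) ⟩
    (∑ (from lo g) n + 1ℚ) * K              ≡⟨ cong (_* K) (∑+1≡∏1+ ρ lo n) ⟩
    ∏1+ ρ lo n * K                          ≡⟨ *-comm (∏1+ ρ lo n) K ⟩
    K * ∏1+ ρ lo n                          ∎
    where
    open ≤-Reasoning
    f g : ℕ → ℚ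
    f m = recip m ^ℚ suc i * Msum I (suc m) n
    g m = ρ m * ∏1+ ρ (suc m) n
    K = two ^ℚ suc (length I)
    0≤K : 0ℚ ≤ K
    0≤K = 0≤^ℚ (+-mono-≤ 0≤1 0≤1) (suc (length I))
    regroup : ∀ q w P → q * (w * P) ≡ (½ * q * P) * (two * w)
    regroup = solve-∀ ℚ-ring
    f≤g*K : ∀ m → from lo f m ≤ from lo g m * K
    f≤g*K m = ≤-trans (from-mono-≤ lo f≤ m) (≤-reflexive (sym (from-*ʳ lo g K m)))
      where
      f≤ : ∀ m → f m ≤ g m * K
      f≤ m = ≤-trans (*-mono-≤-0≤ (0≤^ℚ (0≤recip m) (suc i)) (Msum-0≤ I (suc m) n)
                                  (^ℚ-suc-≤ (0≤recip m) (recip≤1 m) i) (Msum≤ I I≢0 (suc m) n))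
                     (≤-reflexive (regroup (recip m) (two ^ℚ length I) (∏1+ ρ (suc m) n)))

  weight : QSym → ℚ
  weight []                = 0ℚ
  weight ((c , I , _) ∷ u) = ∣ c ∣ * two ^ℚ length I + weight u

  0≤weight : ∀ u → 0ℚ ≤ weight u
  0≤weight []                = ≤-refl
  0≤weight ((c , I , _) ∷ u) = +-mono-≤ (*-0≤ (0≤∣p∣ c) (0≤^ℚ (+-mono-≤ 0≤1 0≤1) (length I))) (0≤weight u)

  ∣evalQ∣≤ : ∀ u n → ∣ evalQ u n ∣ ≤ weight u * ∏1+ ρ 0 n
  ∣evalQ∣≤ []                  n = ≤-reflexive (sym (*-zeroˡ (∏1+ ρ 0 n)))
  ∣evalQ∣≤ ((c , I , I≢0) ∷ u) n = begin
    ∣ c * M + evalQ u n ∣             ≤⟨ ∣p+q∣≤∣p∣+∣q∣ (c * M) (evalQ u n) ⟩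
    ∣ c * M ∣ + ∣ evalQ u n ∣         ≡⟨ cong (_+ ∣ evalQ u n ∣) (∣p*q∣≡∣p∣*q c (Msum-0≤ I 0 n)) ⟩
    ∣ c ∣ * M + ∣ evalQ u n ∣         ≤⟨ +-mono-≤ (*-monoˡ-≤-0≤ (0≤∣p∣ c) (Msum≤ I I≢0 0 n)) (∣evalQ∣≤ u n) ⟩
    ∣ c ∣ * (w * P) + weight u * P    ≡⟨ factor ∣ c ∣ w P (weight u) ⟩
    (∣ c ∣ * w + weight u) * P        ∎
    where
    open ≤-Reasoning
    M = Msum I 0 n
    P = ∏1+ ρ 0 n
    w = two ^ℚ length I
    factor : ∀ a w P C → a * (w * P) + C * P ≡ (a * w + C) * P
    factor = solve-∀ ℚ-ring

  n^∑s≤denomFrom : ∀ s n → n ℕ.^ sum s ℕ.≤ denomFrom s n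
  n^∑s≤denomFrom []      n = ℕ.≤-refl
  n^∑s≤denomFrom (k ∷ s) n = begin
    n ℕ.^ (k ℕ.+ sum s)             ≡⟨ ℕ.^-distribˡ-+-* n k (sum s) ⟩
    n ℕ.^ k ℕ.* n ℕ.^ sum s         ≤⟨ ℕ.*-monoʳ-≤ (n ℕ.^ k) (ℕ.^-monoˡ-≤ (sum s) (ℕ.n≤1+n n)) ⟩
    n ℕ.^ k ℕ.* suc n ℕ.^ sum s     ≤⟨ ℕ.*-monoʳ-≤ (n ℕ.^ k) (n^∑s≤denomFrom s (suc n)) ⟩
    n ℕ.^ k ℕ.* denomFrom s (suc n) ∎
    where open ℕ.≤-Reasoning

  etaTerm≡ : ∀ s u n {D} → denomFrom s (suc n) ≡ suc D → etaTerm s u n ≡ evalQ u (suc n) * recip D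
  etaTerm≡ s u n eq rewrite eq = refl

  -- Π n = ∏_{k=1}^{n+1} (1 + 1/(2k)), since etaTerm s u n is the term of index n + 1.
  Π : ℕ → ℚ
  Π n = ∏1+ ρ 0 (suc n)

  0≤Π : ∀ n → 0ℚ ≤ Π n
  0≤Π n = 0≤∏1+ 0≤ρ 0 (suc n)

  β : ℕ → ℚ
  β n = Π n * (recip n * recip n)

  ∣etaTerm∣≤ : ∀ s → 2 ℕ.≤ sum s → ∀ u n → ∣ etaTerm s u n ∣ ≤ weight u * β n
  ∣etaTerm∣≤ s 2≤∑s u n = begin
    ∣ etaTerm s u n ∣                       ≡⟨ cong ∣_∣ (etaTerm≡ s u n d≡1+D) ⟩
    ∣ evalQ u (suc n) * recip D ∣           ≡⟨ ∣p*q∣≡∣p∣*q (evalQ u (suc n)) (0≤recip D) ⟩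
    ∣ evalQ u (suc n) ∣ * recip D           ≤⟨ *-mono-≤-0≤ (0≤∣p∣ _) (0≤recip D) (∣evalQ∣≤ u (suc n)) 1/D≤1/n² ⟩
    (weight u * Π n) * (recip n * recip n)  ≡⟨ *-assoc (weight u) (Π n) _ ⟩
    weight u * β n                          ∎
    where
    open ≤-Reasoning
    d = denomFrom s (suc n)
    n²≤d : suc n ℕ.* suc n ℕ.≤ d
    n²≤d = ℕ.≤-trans (ℕ.≤-reflexive (cong (suc n ℕ.*_) (sym (ℕ.*-identityʳ (suc n)))))
             (ℕ.≤-trans (ℕ.^-monoʳ-≤ (suc n) 2≤∑s) (n^∑s≤denomFrom s (suc n)))
    D = ℕ.pred d
    d≡1+D : d ≡ suc D
    d≡1+D = sym (ℕ.suc-pred d {{ℕ.>-nonZero (ℕ.≤-trans (ℕ.s≤s ℕ.z≤n) n²≤d)}})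
    1/D≤1/n² : recip D ≤ recip n * recip n
    1/D≤1/n² = subst (recip D ≤_) (sym (recip-* n n)) (recip-antitone (ℕ.≤-pred (subst (_ ℕ.≤_) d≡1+D n²≤d)))

  four : ℚ
  four = two * two

  γ : ℕ → ℚ
  γ n = four * (Π n * recip n)

  0≤γ : ∀ n → 0ℚ ≤ γ n
  0≤γ n = *-0≤ (nonNegative⁻¹ four) (*-0≤ (0≤Π n) (0≤recip n))

  β+γ≤γ : ∀ n → β n + γ (suc n) ≤ γ n
  β+γ≤γ n = begin
    Π n * (q * q) + four * ((Π n * c) * q′)     ≡⟨ factor (Π n) q q′ c ⟩
    Π n * (q * q + four * (c * q′))             ≤⟨ *-monoˡ-≤-0≤ (0≤Π n) q²+4cq′≤4q ⟩
    Π n * (four * q)                            ≡⟨ swap (Π n) q ⟩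
    four * (Π n * q)                            ∎
    where
    open ≤-Reasoning
    q = recip n
    q′ = recip (suc n)
    c = 1ℚ + ρ (suc n)
    factor : ∀ P q q′ c → P * (q * q) + four * ((P * c) * q′) ≡ P * (q * q + four * (c * q′))
    factor = solve-∀ ℚ-ring
    swap : ∀ P q → P * (four * q) ≡ four * (P * q)
    swap = solve-∀ ℚ-ring
    q′²≤qq′ : q′ * q′ ≤ q * q′
    q′²≤qq′ = *-monoʳ-≤-0≤ (0≤recip (suc n)) (recip-antitone (ℕ.n≤1+n n))
    expand : ∀ q q′ → q * q + four * ((1ℚ + ½ * q′) * q′) ≡ q * q + (four * q′ + two * (q′ * q′))
    expand = solve-∀ ℚ-ring
    collect : ∀ q q′ → q * (two * q′) + (four * q′ + two * (q * q′)) ≡ four * (q′ + q * q′)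
    collect = solve-∀ ℚ-ring
    q²+4cq′≤4q : q * q + four * (c * q′) ≤ four * q
    q²+4cq′≤4q = begin
      q * q + four * (c * q′)                       ≡⟨ expand q q′ ⟩
      q * q + (four * q′ + two * (q′ * q′))         ≤⟨ +-mono-≤ (*-monoˡ-≤-0≤ (0≤recip n) (recip≤two*recip-suc n))
                                                                 (+-monoʳ-≤ (four * q′) (*-monoˡ-≤-0≤ (nonNegative⁻¹ two) q′²≤qq′)) ⟩
      q * (two * q′) + (four * q′ + two * (q * q′)) ≡⟨ collect q q′ ⟩
      four * (q′ + q * q′)                          ≡⟨ cong (four *_) (recip-suc n) ⟩
      four * q                                      ∎

  Π²/n : ℕ → ℚ
  Π²/n n = Π n * Π n * recip n

  Π²/n-suc≤ : ∀ n → Π²/n (suc n) ≤ Π²/n n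
  Π²/n-suc≤ n = begin
    (Π n * c) * (Π n * c) * q′                ≡⟨ regroup (Π n) c q′ ⟩
    Π n * Π n * (c * c * q′)                  ≤⟨ *-monoˡ-≤-0≤ (*-0≤ (0≤Π n) (0≤Π n)) c²q′≤q ⟩
    Π n * Π n * q                             ∎
    where
    open ≤-Reasoning
    q = recip n
    q′ = recip (suc n)
    c = 1ℚ + ρ (suc n)
    regroup : ∀ P c q′ → (P * c) * (P * c) * q′ ≡ P * P * (c * c * q′)
    regroup = solve-∀ ℚ-ring
    expand : ∀ q′ → (1ℚ + ½ * q′) * (1ℚ + ½ * q′) * q′ ≡ q′ + q′ * q′ + (½ * ½ * q′) * (q′ * q′)
    expand = solve-∀ ℚ-ring
    collect : ∀ q q′ → q′ + q′ * q′ + q * (q′ * q′) ≡ q′ + (q′ + q * q′) * q′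
    collect = solve-∀ ℚ-ring
    ¼≤1 : ½ * ½ ≤ 1ℚ
    ¼≤1 = *≤* (ℤ.+≤+ (ℕ.s≤s ℕ.z≤n))
    0≤q′² : 0ℚ ≤ q′ * q′
    0≤q′² = *-0≤ (0≤recip (suc n)) (0≤recip (suc n))
    q′/4≤q : ½ * ½ * q′ ≤ q
    q′/4≤q = begin
      ½ * ½ * q′    ≤⟨ *-monoʳ-≤-0≤ (0≤recip (suc n)) ¼≤1 ⟩
      1ℚ * q′       ≡⟨ *-identityˡ q′ ⟩
      q′            ≤⟨ recip-antitone (ℕ.n≤1+n n) ⟩
      q             ∎
    c²q′≤q : c * c * q′ ≤ q
    c²q′≤q = begin
      c * c * q′                                ≡⟨ expand q′ ⟩
      q′ + q′ * q′ + (½ * ½ * q′) * (q′ * q′)   ≤⟨ +-monoʳ-≤ (q′ + q′ * q′) (*-monoʳ-≤-0≤ 0≤q′² q′/4≤q) ⟩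
      q′ + q′ * q′ + q * (q′ * q′)              ≡⟨ collect q q′ ⟩
      q′ + (q′ + q * q′) * q′                   ≡⟨ cong (λ x → q′ + x * q′) (recip-suc n) ⟩
      q′ + q * q′                               ≡⟨ recip-suc n ⟩
      q                                         ∎

  Π²/n≤Π²/0 : ∀ n → Π²/n n ≤ Π²/n 0
  Π²/n≤Π²/0 zero    = ≤-refl
  Π²/n≤Π²/0 (suc n) = ≤-trans (Π²/n-suc≤ n) (Π²/n≤Π²/0 n)

  c*γ→0 : ∀ {c} → 0ℚ ≤ c → ∀ ε → Positive ε → ∃[ N ] c * γ N < ε
  c*γ→0 {c} 0≤c ε ε>0 = from-archimedean (archimedean (K * Π²/n 0) (ε * ε) 0<ε²)
    where
    open ≤-Reasoning
    K = four * four * (c * c)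
    0≤K : 0ℚ ≤ K
    0≤K = *-0≤ (nonNegative⁻¹ (four * four)) (*-0≤ 0≤c 0≤c)
    0<ε² : 0ℚ < ε * ε
    0<ε² = positive⁻¹ (ε * ε) {{pos*pos⇒pos ε {{ε>0}} ε {{ε>0}}}}
    regroup : ∀ c P q → (c * (four * (P * q))) * (c * (four * (P * q))) ≡ four * four * (c * c) * (P * P * q) * q
    regroup = solve-∀ ℚ-ring
    from-archimedean : ∃[ N ] K * Π²/n 0 * recip N < ε * ε → ∃[ N ] c * γ N < ε
    from-archimedean (N , small) = N , p²<q²⇒p<q (<⇒≤ (positive⁻¹ ε {{ε>0}})) (begin-strict
      (c * γ N) * (c * γ N)     ≡⟨ regroup c (Π N) (recip N) ⟩
      K * Π²/n N * recip N      ≤⟨ *-monoʳ-≤-0≤ (0≤recip N) (*-monoˡ-≤-0≤ 0≤K (Π²/n≤Π²/0 N)) ⟩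
      K * Π²/n 0 * recip N      <⟨ small ⟩
      ε * ε                     ∎)

open Estimates
open import Data.List using (List)
open import Data.Nat using (ℕ; _≤_)
open import Data.Nat.ListAction using (sum)
open import Data.Rational using (_*_)

theorem4p1 : (s : List ℕ) → 2 ≤ sum s → (u : QSym) →
    CauchySeq (partialEta s u)
theorem4p1 s 2≤∑s u =
  ∑-cauchy-by-telescoping (etaTerm s u) (λ n → C * β n) (λ n → C * γ n)
    (∣etaTerm∣≤ s 2≤∑s u) (*-telescoping 0≤C β+γ≤γ) (λ n → *-0≤ 0≤C (0≤γ n)) (c*γ→0 0≤C)
  where
  C = weight u
  0≤C = 0≤weight u
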